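{- Let $n\ge2$ be an integer and $(G,R)$ an abelian cyclically ordered group. Then $G$ has an element of order exactly $n$ if and only if $z_G$ is divisible by $n$ in ${\rm uw}(G)$, i.e. there is $x\in{\rm uw}(G)$ with $nx=z_G$.
   Context: A cyclically ordered group is a group $G$ with a ternary relation $R$ that is strict ($R(a,b,c)$ implies $a,b,c$ pairwise distinct), cyclic ($R(a,b,c)\Rightarrow R(b,c,a)$), such that each $R(g,\cdot,\cdot)$ is a strict linear order on $G\setminus\{g\}$, and compatible with the group operation. The unwound $({\rm uw}(G),\le_R)$ of $(G,R)$ (written multiplicatively with identity $e$) is the set $\mathbb{Z}\times G$ with the order $(n,g)\le_R(n',g')$ iff $n<n'$ or [$n=n'$ and ($g=e$ or $R(e,g,g')$ or $g=g'$)], and the operation $(n,g)\cdot(n',g')=(n+n',gg')$ if $g=e$ or $g'=e$ or $R(e,g,gg')$, and $(n,g)\cdot(n',g')=(n+n'+1,gg')$ otherwise. It is a linearly ordered group, $z_G=(1,e)$ is a positive central cofinal element, and $(G,R)$ is c-isomorphic to ${\rm uw}(G)/\langle z_G\rangle$ with the wound-round cyclic order. For abelian $G$, ${\rm uw}(G)$ is abelian and is written additively. -}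

module Defs where

open import Level using (Level; _⊔_; suc)
open import Data.Nat using (ℕ; zero; _<_; _≤_)
open import Data.Integer using (ℤ; +_) renaming (_+_ to _+ℤ_; suc to sucℤ)
open import Data.Product using (_×_; Σ; ∃; _,_)
open import Data.Sum using (_⊎_)
open import Relation.Nullary using (¬_)
open import Relation.Binary.PropositionalEquality using (_≡_)
open import Algebra.Bundles using (AbelianGroup)
import Algebra.Definitions.RawMonoid as RM

-- A cyclic order on an abelian group G (written multiplicatively: _∙_, ε).
-- Since stdlib groups come with a setoid equality _≈_, "distinct" means ¬ _≈_,
-- and R is required to respect _≈_.
record IsCyclicOrder {c ℓ} (G : AbelianGroup c ℓ) (r : Level)
       (R : AbelianGroup.Carrier G → AbelianGroup.Carrier G → AbelianGroup.Carrier G → Set r)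
       : Set (c ⊔ ℓ ⊔ r) where
  open AbelianGroup G
  field
    R-resp-≈ : ∀ {a b c a' b' c'} → a ≈ a' → b ≈ b' → c ≈ c' → R a b c → R a' b' c'
    strict   : ∀ {a b c} → R a b c → (¬ a ≈ b) × (¬ b ≈ c) × (¬ a ≈ c)
    cyclic   : ∀ {a b c} → R a b c → R b c a
    -- each R(g,·,·) is a strict linear order on G ∖ {g}
    -- (irreflexivity follows from strictness)
    asym     : ∀ {g a b} → R g a b → ¬ R g b a
    trans    : ∀ {g a b d} → R g a b → R g b d → R g a d
    total    : ∀ {g a b} → ¬ a ≈ g → ¬ b ≈ g → ¬ a ≈ b → R g a b ⊎ R g b a
    compat   : ∀ {a b c d} → R a b c → R (d ∙ a) (d ∙ b) (d ∙ c)

record AbelianCOGroup (c ℓ r : Level) : Set (Level.suc (c ⊔ ℓ ⊔ r)) where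
  field
    abGroup : AbelianGroup c ℓ
  open AbelianGroup abGroup public
  field
    R       : Carrier → Carrier → Carrier → Set r
    isCyclicOrder : IsCyclicOrder abGroup r R

module UW {c ℓ r} (G : AbelianCOGroup c ℓ r) where
  open AbelianCOGroup G
  open RM rawMonoid public using () renaming (_×_ to _^′_)

  _^_ : Carrier → ℕ → Carrier
  g ^ n = n ^′ g

  HasOrder : Carrier → ℕ → Set ℓ
  HasOrder g n = (g ^ n ≈ ε) × (∀ k → 1 ≤ k → k < n → ¬ (g ^ k ≈ ε))

  UWCarrier : Set c
  UWCarrier = ℤ × Carrier

  _≈uw_ : UWCarrier → UWCarrier → Set ℓ
  (m , g) ≈uw (m' , g') = (m ≡ m') × (g ≈ g')

  NoCarry : Carrier → Carrier → Set (ℓ ⊔ r)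
  NoCarry g g' = (g ≈ ε) ⊎ (g' ≈ ε) ⊎ R ε g (g ∙ g')

  -- Graph of the unwound operation: Add x y z  iff  x · y = z in uw(G).
  -- (The operation is given by a case distinction which is not decidable
  -- constructively, so we describe it via its graph.)
  Add : UWCarrier → UWCarrier → UWCarrier → Set (ℓ ⊔ r)
  Add (m , g) (m' , g') (k , h) =
    (h ≈ g ∙ g') ×
    ((NoCarry g g' × (k ≡ m +ℤ m')) ⊎ (¬ NoCarry g g' × (k ≡ sucℤ (m +ℤ m'))))

  0uw : UWCarrier
  0uw = (+ 0 , ε)

  data Mult : ℕ → UWCarrier → UWCarrier → Set (c ⊔ ℓ ⊔ r) where
    mult-zero : ∀ {x y} → y ≈uw 0uw → Mult zero x y
    mult-suc  : ∀ {n x w y} → Mult n x w → Add x w y → Mult (Data.Nat.suc n) x y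

  zG : UWCarrier
  zG = (+ 1 , ε)

-- A carry occurs in the unwound sum (m , a) + w exactly when the G-component passes
-- through ε. So if n (m , a) = z_G, the integer part 1 = n m + (number of carries)
-- forces exactly one carry, which rules out a^k = ε for 1 ≤ k < n. Conversely, if g
-- has order n, let h be the first element of ⟨g⟩ ∖ {ε} after ε in the cyclic order;
-- h generates ⟨g⟩, so it has order n, and n (0 , h) = z_G with a single carry at the
-- last step because h precedes all its other powers.
module Submission where

open import Defs
open import Level using (_⊔_)
open import Data.Nat using (ℕ; _≤_)
open import Data.Product using (∃)
open import Function.Bundles using (_⇔_)

open import Data.Nat as ℕ using (zero; suc; z≤n; s≤s; s≤s⁻¹; _<_; _≟_; NonZero)
open import Data.Nat.Properties as ℕₚ
  using (≤-refl; ≤-trans; <-trans; <-irrefl; m≤n⇒m≤1+n; m≤n⇒m<n∨m≡n; ≤∧≢⇒<; n<1+n)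
open import Data.Nat.DivMod using (_%_; _/_; m≡m%n+[m/n]*n; m%n<n)
open import Data.Integer using (ℤ; +_; -[1+_]; -_; _⊖_) renaming (_+_ to _+ℤ_; _*_ to _*ℤ_; suc to sucℤ)
import Data.Integer.Properties as ℤₚ
open import Data.Integer.Tactic.RingSolver using (solve-∀)
open import Data.Product using (_,_; proj₁; proj₂; ∃-syntax) renaming (_×_ to _∧_)
open import Data.Sum using (_⊎_; inj₁; inj₂)
open import Function using (_∘_)
open import Function.Bundles using (mk⇔)
open import Relation.Binary.Definitions using (Transitive)
open import Relation.Nullary using (¬_; yes; no; contradiction)
open import Relation.Binary.PropositionalEquality as ≡ using (_≡_; _≢_)

least-index : ∀ {a r} {A : Set a} (_≺_ : A → A → Set r) → Transitive _≺_ →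
  (f : ℕ → A) (t : ℕ) → (∀ {i j} → i < j → j ≤ t → f i ≺ f j ⊎ f j ≺ f i) →
  ∃[ j ] j ≤ t ∧ (∀ {i} → i ≤ t → i ≢ j → f j ≺ f i)
least-index _≺_ ≺-trans f zero compare = 0 , z≤n , λ i≤0 i≢0 → contradiction (ℕₚ.n≤0⇒n≡0 i≤0) i≢0
least-index _≺_ ≺-trans f (suc t) compare
  with least-index _≺_ ≺-trans f t (λ i<j j≤t → compare i<j (m≤n⇒m≤1+n j≤t))
... | j , j≤t , least with compare (s≤s j≤t) ≤-refl
...   | inj₁ fj≺ = j , m≤n⇒m≤1+n j≤t , extend
  where
  extend : ∀ {i} → i ≤ suc t → i ≢ j → f j ≺ f i
  extend i≤ i≢j with m≤n⇒m<n∨m≡n i≤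
  ... | inj₁ i<1+t = least (s≤s⁻¹ i<1+t) i≢j
  ... | inj₂ ≡.refl = fj≺
...   | inj₂ ≺fj = suc t , ≤-refl , extend
  where
  extend : ∀ {i} → i ≤ suc t → i ≢ suc t → f (suc t) ≺ f i
  extend {i} i≤ i≢ with i ≟ j
  ... | yes ≡.refl = ≺fj
  ... | no i≢j = ≺-trans ≺fj (least (s≤s⁻¹ (≤∧≢⇒< i≤ i≢)) i≢j)

1≡n*m+c⇒c≡1 : ∀ {n c} (m : ℤ) → 2 ≤ n → c ≤ n → + 1 ≡ + n *ℤ m +ℤ + c → c ≡ 1
1≡n*m+c⇒c≡1 {n} {c} (+ zero) _ _ eq =
  ≡.sym (ℤₚ.+-injective (≡.trans eq (≡.cong (_+ℤ + c) (ℤₚ.*-zeroʳ (+ n)))))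
1≡n*m+c⇒c≡1 {n} {c} (+ suc q) 2≤n _ eq = contradiction 2≤1 (<-irrefl ≡.refl)
  where
  1≡n*[1+q]+c : 1 ≡ n ℕ.* suc q ℕ.+ c
  1≡n*[1+q]+c = ℤₚ.+-injective (≡.trans eq (≡.cong (_+ℤ + c) (≡.sym (ℤₚ.pos-* n (suc q)))))
  2≤1 : 2 ≤ 1
  2≤1 = ≡.subst (2 ≤_) (≡.sym 1≡n*[1+q]+c)
    (≤-trans 2≤n (≤-trans (ℕₚ.m≤m*n n (suc q)) (ℕₚ.m≤m+n _ c)))
1≡n*m+c⇒c≡1 {n} {c} -[1+ q ] _ c≤n eq = contradiction 1≡-[n*[1+q]∸c] 1≢-k
  where
  open ≡.≡-Reasoning
  1≡-[n*[1+q]∸c] : + 1 ≡ - + (n ℕ.* suc q ℕ.∸ c)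
  1≡-[n*[1+q]∸c] = begin
    + 1                             ≡⟨ eq ⟩
    + n *ℤ -[1+ q ] +ℤ + c          ≡⟨ ≡.cong (_+ℤ + c) (≡.sym (ℤₚ.neg-distribʳ-* (+ n) (+ suc q))) ⟩
    - (+ n *ℤ + suc q) +ℤ + c       ≡⟨ ≡.cong (λ z → - z +ℤ + c) (≡.sym (ℤₚ.pos-* n (suc q))) ⟩
    - + (n ℕ.* suc q) +ℤ + c        ≡⟨ ℤₚ.-m+n≡n⊖m (n ℕ.* suc q) c ⟩
    c ⊖ n ℕ.* suc q                 ≡⟨ ℤₚ.⊖-≤ (≤-trans c≤n (ℕₚ.m≤m*n n (suc q))) ⟩
    - + (n ℕ.* suc q ℕ.∸ c)         ∎
  1≢-k : ∀ {k} → + 1 ≢ - + k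
  1≢-k {zero} ()
  1≢-k {suc k} ()

unwound-step : ∀ (m j c : ℤ) → m +ℤ (j *ℤ m +ℤ c) ≡ (+ 1 +ℤ j) *ℤ m +ℤ c
unwound-step = solve-∀

unwound-step-carry : ∀ (m j c : ℤ) → + 1 +ℤ (m +ℤ (j *ℤ m +ℤ c)) ≡ (+ 1 +ℤ j) *ℤ m +ℤ (+ 1 +ℤ c)
unwound-step-carry = solve-∀

module _ {c ℓ r} (G : AbelianCOGroup c ℓ r) where
  open AbelianCOGroup G
  open IsCyclicOrder isCyclicOrder
    renaming ( trans to R-trans; total to R-total; compat to R-compat
             ; cyclic to R-cyclic; strict to R-strict)
  open UW G
  open import Algebra.Properties.Monoid.Mult monoid using (×-homo-+; ×-assocˡ; ×-congʳ)
  open import Algebra.Properties.Group group using (∙-cancelˡ; inverseˡ-unique)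
  open import Relation.Binary.Reasoning.Setoid setoid

  ^-cong : ∀ {a b} k → a ≈ b → a ^ k ≈ b ^ k
  ^-cong k = ×-congʳ k

  ^-+ : ∀ a i j → a ^ (i ℕ.+ j) ≈ a ^ i ∙ a ^ j
  ^-+ = ×-homo-+

  ^-* : ∀ a i j → (a ^ i) ^ j ≈ a ^ (j ℕ.* i)
  ^-* a i j = ×-assocˡ a j i

  ε^ : ∀ k → ε ^ k ≈ ε
  ε^ zero = refl
  ε^ (suc k) = trans (identityˡ _) (ε^ k)

  ^-*-ε : ∀ {a m} k → a ^ m ≈ ε → a ^ (k ℕ.* m) ≈ ε
  ^-*-ε {a} {m} k aᵐ≈ε = begin
    a ^ (k ℕ.* m)  ≈⟨ ^-* a m k ⟨
    (a ^ m) ^ k    ≈⟨ ^-cong k aᵐ≈ε ⟩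
    ε ^ k          ≈⟨ ε^ k ⟩
    ε              ∎

  ^-^-ε : ∀ {a m} k → a ^ m ≈ ε → (a ^ k) ^ m ≈ ε
  ^-^-ε {a} {m} k aᵐ≈ε = begin
    (a ^ k) ^ m     ≈⟨ ^-* a k m ⟩
    a ^ (m ℕ.* k)   ≡⟨ ≡.cong (a ^_) (ℕₚ.*-comm m k) ⟩
    a ^ (k ℕ.* m)   ≈⟨ ^-*-ε k aᵐ≈ε ⟩
    ε               ∎

  ^-mod : ∀ {a} n .{{_ : NonZero n}} → a ^ n ≈ ε → ∀ i → a ^ i ≈ a ^ (i % n)
  ^-mod {a} n aⁿ≈ε i = begin
    a ^ i                              ≡⟨ ≡.cong (a ^_) (m≡m%n+[m/n]*n i n) ⟩
    a ^ (i % n ℕ.+ (i / n) ℕ.* n)      ≈⟨ ^-+ a (i % n) _ ⟩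
    a ^ (i % n) ∙ a ^ ((i / n) ℕ.* n)  ≈⟨ ∙-congˡ (^-*-ε (i / n) aⁿ≈ε) ⟩
    a ^ (i % n) ∙ ε                    ≈⟨ identityʳ _ ⟩
    a ^ (i % n)                        ∎

  x∙y≈x⇒y≈ε : ∀ a b → a ∙ b ≈ a → b ≈ ε
  x∙y≈x⇒y≈ε a b e = ∙-cancelˡ a b ε (trans e (sym (identityʳ a)))

  order-distinct : ∀ {g n} → HasOrder g n → ∀ {i j} → i < j → j < n → ¬ g ^ i ≈ g ^ j
  order-distinct {g} (_ , below) {i} {j} i<j j<n gⁱ≈gʲ =
    below (j ℕ.∸ i) (ℕₚ.m<n⇒0<n∸m i<j) (ℕₚ.≤-<-trans (ℕₚ.m∸n≤m j i) j<n)
      (x∙y≈x⇒y≈ε (g ^ i) (g ^ (j ℕ.∸ i)) (begin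
        g ^ i ∙ g ^ (j ℕ.∸ i)    ≈⟨ comm _ _ ⟩
        g ^ (j ℕ.∸ i) ∙ g ^ i    ≈⟨ ^-+ g (j ℕ.∸ i) i ⟨
        g ^ (j ℕ.∸ i ℕ.+ i)      ≡⟨ ≡.cong (g ^_) (ℕₚ.m∸n+n≡m (ℕₚ.<⇒≤ i<j)) ⟩
        g ^ j                    ≈⟨ gⁱ≈gʲ ⟨
        g ^ i                    ∎))

  R-compose : ∀ {a b e d} → R a e d → R e b d → R a b d
  R-compose aed ebd = R-cyclic (R-trans (R-cyclic (R-cyclic aed)) (R-cyclic (R-cyclic ebd)))

  record IsSubgroup {p} (P : Carrier → Set p) : Set (c ⊔ ℓ ⊔ p) where
    field
      resp     : ∀ {a b} → a ≈ b → P a → P b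
      ∙-closed : ∀ {a b} → P a → P b → P (a ∙ b)
      ⁻¹-closed : ∀ {a} → P a → P (a ⁻¹)

    ^-closed : ∀ {a} k → P a → P (a ^ suc k)
    ^-closed zero a∈P = resp (sym (identityʳ _)) a∈P
    ^-closed (suc k) a∈P = ∙-closed a∈P (^-closed k a∈P)

  IsLeastIn : ∀ {p} → (Carrier → Set p) → Carrier → Set (c ⊔ ℓ ⊔ r ⊔ p)
  IsLeastIn P h = P h ∧ (∀ {b} → P b → ¬ b ≈ ε → ¬ b ≈ h → R ε h b)

  least-generates : ∀ {p} {P : Carrier → Set p} {h} → IsSubgroup P → IsLeastIn P h →
    ∀ {m} → h ^ suc m ≈ ε → ∀ {g} → P g → ¬ (∀ k → ¬ g ≈ h ^ k)
  least-generates {h = h} sub (h∈P , least) {m} hᵐ⁺¹≈ε {g} g∈P g∉⟨h⟩ =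
    proj₁ (R-strict (h^k<g m)) (sym hᵐ⁺¹≈ε)
    where
    open IsSubgroup sub
    -- the powers h, h², … all lie strictly between ε and g, so none of them is ε
    h^k<g : ∀ k → R ε (h ^ suc k) g
    h^k<g zero = R-resp-≈ refl (sym (identityʳ h)) refl
      (least g∈P (g∉⟨h⟩ 0) (g∉⟨h⟩ 1 ∘ λ g≈h → trans g≈h (sym (identityʳ h))))
    h^k<g (suc k) = R-resp-≈ (inverseʳ q) (comm q h) q∙b≈g (R-compat {d = q} q⁻¹<h<b)
      where
      q = h ^ suc k
      b = q ⁻¹ ∙ g
      q∙b≈g : q ∙ b ≈ g
      q∙b≈g = trans (sym (assoc q (q ⁻¹) g)) (trans (∙-congʳ (inverseʳ q)) (identityˡ g))
      q⁻¹<ε<b : R (q ⁻¹) ε b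
      q⁻¹<ε<b = R-resp-≈ (identityʳ _) (inverseˡ q) refl (R-compat {d = q ⁻¹} (h^k<g k))
      h<b : R ε h b
      h<b = least (∙-closed (⁻¹-closed (^-closed k h∈P)) g∈P)
        (λ b≈ε → g∉⟨h⟩ (suc k) (trans (sym q∙b≈g) (trans (∙-congˡ b≈ε) (identityʳ q))))
        (λ b≈h → g∉⟨h⟩ (suc (suc k)) (trans (sym q∙b≈g) (trans (∙-congˡ b≈h) (comm q h))))
      q⁻¹<h<b : R (q ⁻¹) h b
      q⁻¹<h<b = R-compose q⁻¹<ε<b h<b

  Powers : Carrier → Carrier → Set ℓ
  Powers g b = ∃[ i ] b ≈ g ^ i

  powers-isSubgroup : ∀ {g k} → g ^ suc k ≈ ε → IsSubgroup (Powers g)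
  powers-isSubgroup {g} {k} gᵏ⁺¹≈ε = record
    { resp      = λ { a≈b (i , a≈gⁱ) → i , trans (sym a≈b) a≈gⁱ }
    ; ∙-closed  = λ { (i , a≈gⁱ) (j , b≈gʲ) → i ℕ.+ j , trans (∙-cong a≈gⁱ b≈gʲ) (sym (^-+ g i j)) }
    ; ⁻¹-closed = λ { {a} (i , a≈gⁱ) → i ℕ.* k , trans (⁻¹-cong a≈gⁱ) (sym (inverse-of-power i)) }
    }
    where
    inverse-of-power : ∀ i → g ^ (i ℕ.* k) ≈ (g ^ i) ⁻¹
    inverse-of-power i = inverseˡ-unique _ _ (begin
      g ^ (i ℕ.* k) ∙ g ^ i    ≈⟨ comm _ _ ⟩
      g ^ i ∙ g ^ (i ℕ.* k)    ≈⟨ ^-+ g i (i ℕ.* k) ⟨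
      g ^ (i ℕ.+ i ℕ.* k)      ≡⟨ ≡.cong (g ^_) (ℕₚ.*-suc i k) ⟨
      g ^ (i ℕ.* suc k)        ≈⟨ ^-*-ε i gᵏ⁺¹≈ε ⟩
      ε                        ∎)

  least-power : ∀ {g n} → 2 ≤ n → HasOrder g n → ∃[ h ] IsLeastIn (Powers g) h
  least-power {g} {suc (suc t)} (s≤s (s≤s _)) ord@(gⁿ≈ε , below) =
    g ^ suc j , (suc j , refl) , least
    where
    n = suc (suc t)
    power≉ε : ∀ {i} → i ≤ t → ¬ g ^ suc i ≈ ε
    power≉ε i≤t = below (suc _) (s≤s z≤n) (s≤s (s≤s i≤t))
    compare : ∀ {i j} → i < j → j ≤ t → R ε (g ^ suc i) (g ^ suc j) ⊎ R ε (g ^ suc j) (g ^ suc i)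
    compare i<j j≤t = R-total (power≉ε (ℕₚ.<⇒≤ (ℕₚ.<-≤-trans i<j j≤t))) (power≉ε j≤t)
      (order-distinct ord (s≤s i<j) (s≤s (s≤s j≤t)))
    found = least-index (R ε) R-trans (λ i → g ^ suc i) t compare
    j = proj₁ found
    minimal : ∀ {i} → i ≤ t → i ≢ j → R ε (g ^ suc j) (g ^ suc i)
    minimal = proj₂ (proj₂ found)
    least : ∀ {b} → Powers g b → ¬ b ≈ ε → ¬ b ≈ g ^ suc j → R ε (g ^ suc j) b
    least {b} (i , b≈gⁱ) b≉ε b≉gʲ⁺¹ =
      from-residue (i % n) (m%n<n i n) (trans b≈gⁱ (^-mod n gⁿ≈ε i))
      where
      from-residue : ∀ s → s < n → b ≈ g ^ s → R ε (g ^ suc j) b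
      from-residue zero _ b≈ε = contradiction b≈ε b≉ε
      from-residue (suc s) s<n b≈gˢ with s ≟ j
      ... | yes ≡.refl = contradiction b≈gˢ b≉gʲ⁺¹
      ... | no s≢j = R-resp-≈ refl refl (sym b≈gˢ) (minimal (s≤s⁻¹ (s≤s⁻¹ s<n)) s≢j)

  least-power-order : ∀ {g h n} → HasOrder g (suc n) → IsLeastIn (Powers g) h → HasOrder h (suc n)
  least-power-order {g} {h} {n} (gⁿ≈ε , below) least@((i , h≈gⁱ) , _) = hⁿ≈ε , h-below
    where
    hⁿ≈ε : h ^ suc n ≈ ε
    hⁿ≈ε = trans (^-cong (suc n) h≈gⁱ) (^-^-ε {g} {suc n} i gⁿ≈ε)
    h-below : ∀ m → 1 ≤ m → m < suc n → ¬ h ^ m ≈ ε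
    h-below (suc m) _ m<n hᵐ≈ε =
      least-generates (powers-isSubgroup {k = n} gⁿ≈ε) least {m = m} hᵐ≈ε
        (1 , sym (identityʳ g)) g∉⟨h⟩
      where
      g∉⟨h⟩ : ∀ k → ¬ g ≈ h ^ k
      g∉⟨h⟩ k g≈hᵏ = below (suc m) (s≤s z≤n) m<n
        (trans (^-cong (suc m) g≈hᵏ) (^-^-ε {h} {suc m} k hᵐ≈ε))

  least-precedes-powers : ∀ {p} {P : Carrier → Set p} {h n} → IsSubgroup P → IsLeastIn P h →
    HasOrder h n → ∀ {i} → suc (suc i) < n → R ε h (h ^ suc (suc i))
  least-precedes-powers {h = h} sub (h∈P , least) (_ , below) {i} i+2<n =
    least (IsSubgroup.^-closed sub (suc i) h∈P) (below (suc (suc i)) (s≤s z≤n) i+2<n)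
      (below (suc i) (s≤s z≤n) (<-trans (n<1+n _) i+2<n) ∘ x∙y≈x⇒y≈ε h (h ^ suc i))

  ∙≈ε⇒¬NoCarry : ∀ {a b} → ¬ a ≈ ε → a ∙ b ≈ ε → ¬ NoCarry a b
  ∙≈ε⇒¬NoCarry a≉ε _ (inj₁ a≈ε) = a≉ε a≈ε
  ∙≈ε⇒¬NoCarry {a} a≉ε ab≈ε (inj₂ (inj₁ b≈ε)) =
    a≉ε (trans (sym (trans (∙-congˡ b≈ε) (identityʳ a))) ab≈ε)
  ∙≈ε⇒¬NoCarry a≉ε ab≈ε (inj₂ (inj₂ ε<a<ab)) = proj₂ (proj₂ (R-strict ε<a<ab)) (sym ab≈ε)

  mult-without-carry : ∀ {m a} p → (∀ {i} → i < p → NoCarry a (a ^ i)) →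
    Mult p (m , a) (+ p *ℤ m , a ^ p)
  mult-without-carry {m} zero _ = mult-zero (ℤₚ.*-zeroˡ m , refl)
  mult-without-carry {m} (suc p) no-carry =
    mult-suc (mult-without-carry p (no-carry ∘ ℕₚ.m<n⇒m<1+n))
      (refl , inj₁ (no-carry (n<1+n p) , ℤₚ.suc-* (+ p) m))

  order-divides-zG : ∀ {h n} → HasOrder h (suc (suc n)) →
    (∀ {i} → suc (suc i) < suc (suc n) → R ε h (h ^ suc (suc i))) → Mult (suc (suc n)) (+ 0 , h) zG
  order-divides-zG {h} {n} (hⁿ≈ε , below) precedes =
    mult-suc (mult-without-carry (suc n) no-carry)
      (sym hⁿ≈ε , inj₂ (∙≈ε⇒¬NoCarry h≉ε hⁿ≈ε , 1≡1+0+n*0))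
    where
    1≡1+0+n*0 : + 1 ≡ sucℤ (+ 0 +ℤ + suc n *ℤ + 0)
    1≡1+0+n*0 = ≡.cong sucℤ (≡.sym (≡.trans (ℤₚ.+-identityˡ _) (ℤₚ.*-zeroʳ (+ suc n))))
    h≉ε : ¬ h ≈ ε
    h≉ε h≈ε = below 1 (s≤s z≤n) (s≤s (s≤s z≤n)) (trans (identityʳ h) h≈ε)
    no-carry : ∀ {i} → i < suc n → NoCarry h (h ^ i)
    no-carry {zero} _ = inj₂ (inj₁ refl)
    no-carry {suc i} i<n = inj₂ (inj₂ (precedes (s≤s i<n)))

  carries : ∀ {j x y} → Mult j x y → ℕ
  carries (mult-zero _) = 0
  carries (mult-suc d (_ , inj₁ _)) = carries d
  carries (mult-suc d (_ , inj₂ _)) = suc (carries d)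

  mult-proj₂ : ∀ {j x y} → Mult j x y → proj₂ y ≈ proj₂ x ^ j
  mult-proj₂ (mult-zero (_ , b≈ε)) = b≈ε
  mult-proj₂ (mult-suc d (b≈a∙b′ , _)) = trans b≈a∙b′ (∙-congˡ (mult-proj₂ d))

  mult-proj₁ : ∀ {j m a y} (d : Mult j (m , a) y) → proj₁ y ≡ + j *ℤ m +ℤ + carries d
  mult-proj₁ {m = m} (mult-zero (t≡0 , _)) =
    ≡.trans t≡0 (≡.sym (≡.trans (ℤₚ.+-identityʳ _) (ℤₚ.*-zeroˡ m)))
  mult-proj₁ {suc j} {m} (mult-suc d (_ , inj₁ (_ , t≡m+t′))) =
    ≡.trans t≡m+t′ (≡.trans (≡.cong (m +ℤ_) (mult-proj₁ d)) (unwound-step m (+ j) (+ carries d)))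
  mult-proj₁ {suc j} {m} (mult-suc d (_ , inj₂ (_ , t≡1+m+t′))) =
    ≡.trans t≡1+m+t′ (≡.trans (≡.cong (λ t′ → sucℤ (m +ℤ t′)) (mult-proj₁ d))
      (unwound-step-carry m (+ j) (+ carries d)))

  carries-≤ : ∀ {j x y} (d : Mult j x y) → carries d ≤ j
  carries-≤ (mult-zero _) = z≤n
  carries-≤ (mult-suc d (_ , inj₁ _)) = m≤n⇒m≤1+n (carries-≤ d)
  carries-≤ (mult-suc d (_ , inj₂ _)) = s≤s (carries-≤ d)

  carries-ε : ∀ {j x y} → proj₂ x ≈ ε → (d : Mult j x y) → carries d ≡ 0
  carries-ε _ (mult-zero _) = ≡.refl
  carries-ε a≈ε (mult-suc d (_ , inj₁ _)) = carries-ε a≈ε d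
  carries-ε a≈ε (mult-suc d (_ , inj₂ (carry , _))) = contradiction (inj₁ a≈ε) carry

  carries-step : ∀ {j x w y} (d : Mult j x w) (add : Add x w y) → carries d ≤ carries (mult-suc d add)
  carries-step d (_ , inj₁ _) = ≤-refl
  carries-step d (_ , inj₂ _) = ℕₚ.n≤1+n (carries d)

  carries-at-ε : ∀ {j x w y} → ¬ proj₂ x ≈ ε → proj₂ x ^ suc j ≈ ε →
    (d : Mult j x w) (add : Add x w y) → carries (mult-suc d add) ≡ suc (carries d)
  carries-at-ε a≉ε aʲ⁺¹≈ε d (_ , inj₁ (no-carry , _)) =
    contradiction no-carry (∙≈ε⇒¬NoCarry a≉ε (trans (∙-congˡ (mult-proj₂ d)) aʲ⁺¹≈ε))
  carries-at-ε _ _ d (_ , inj₂ _) = ≡.refl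

  carry-before : ∀ {j k x y} → ¬ proj₂ x ≈ ε → proj₂ x ^ k ≈ ε → 1 ≤ k → k ≤ j →
    (d : Mult j x y) → 1 ≤ carries d
  carry-before _ _ 1≤k k≤0 (mult-zero _) = contradiction (≤-trans 1≤k k≤0) λ ()
  carry-before a≉ε aᵏ≈ε 1≤k k≤j+1 (mult-suc d add) with m≤n⇒m<n∨m≡n k≤j+1
  ... | inj₁ k≤j = ≤-trans (carry-before a≉ε aᵏ≈ε 1≤k (s≤s⁻¹ k≤j) d) (carries-step d add)
  ... | inj₂ ≡.refl = ≡.subst (1 ≤_) (≡.sym (carries-at-ε a≉ε aᵏ≈ε d add)) (s≤s z≤n)

  two-carries-before : ∀ {j k l x y} → ¬ proj₂ x ≈ ε → proj₂ x ^ k ≈ ε → proj₂ x ^ l ≈ ε →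
    1 ≤ k → k < l → l ≤ j → (d : Mult j x y) → 2 ≤ carries d
  two-carries-before _ _ _ _ k<l l≤0 (mult-zero _) = contradiction (≤-trans k<l l≤0) λ ()
  two-carries-before a≉ε aᵏ≈ε aˡ≈ε 1≤k k<l l≤j+1 (mult-suc d add) with m≤n⇒m<n∨m≡n l≤j+1
  ... | inj₁ l≤j = ≤-trans (two-carries-before a≉ε aᵏ≈ε aˡ≈ε 1≤k k<l (s≤s⁻¹ l≤j) d) (carries-step d add)
  ... | inj₂ ≡.refl = ≡.subst (2 ≤_) (≡.sym (carries-at-ε a≉ε aˡ≈ε d add))
    (s≤s (carry-before a≉ε aᵏ≈ε 1≤k (s≤s⁻¹ k<l) d))

  order⇒divides-zG : ∀ {g n} → 2 ≤ n → HasOrder g n → ∃[ x ] Mult n x zG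
  order⇒divides-zG {n = suc (suc n)} 2≤n@(s≤s (s≤s _)) ord@(gⁿ≈ε , _) =
    let h , h-least = least-power 2≤n ord
        ordʰ = least-power-order ord h-least
        ⟨g⟩ = powers-isSubgroup {k = suc n} gⁿ≈ε
    in (+ 0 , h) , order-divides-zG ordʰ (least-precedes-powers ⟨g⟩ h-least ordʰ)

  divides-zG⇒order : ∀ {n x} → 2 ≤ n → Mult n x zG → HasOrder (proj₂ x) n
  divides-zG⇒order {n} {m , a} 2≤n d = sym (mult-proj₂ d) , no-smaller
    where
    one-carry : carries d ≡ 1
    one-carry = 1≡n*m+c⇒c≡1 m 2≤n (carries-≤ d) (mult-proj₁ d)
    a≉ε : ¬ a ≈ ε
    a≉ε a≈ε = contradiction (≡.trans (≡.sym one-carry) (carries-ε a≈ε d)) λ ()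
    no-smaller : ∀ k → 1 ≤ k → k < n → ¬ a ^ k ≈ ε
    no-smaller k 1≤k k<n aᵏ≈ε = contradiction
      (≡.subst (2 ≤_) one-carry (two-carries-before a≉ε aᵏ≈ε (sym (mult-proj₂ d)) 1≤k k<n ≤-refl d))
      (<-irrefl ≡.refl)

lemma2p7 : ∀ {c ℓ r} (G : AbelianCOGroup c ℓ r) (n : ℕ) → 2 ≤ n →
    let open UW G in
    (∃ λ g → HasOrder g n) ⇔ (∃ λ x → Mult n x zG)
lemma2p7 G n 2≤n = mk⇔
  (λ (g , ord) → order⇒divides-zG G 2≤n ord)
  (λ (x , d) → proj₂ x , divides-zG⇒order G 2≤n d)
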